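{- For every finite set $X$, every rank function of a matroid on $X$ is a rigid boolean function.
   Context: A boolean function on a finite set $X$ is $f:\mathcal{P}(X)\to\mathbb{Z}$ with $f(\emptyset)=0$. It is the rank function of a matroid if $0\le f(A)\le|A|$ for all $A$, $f$ is increasing ($A\subseteq B\Rightarrow f(A)\le f(B)$), and submodular ($f(A\cup B)+f(A\cap B)\le f(A)+f(B)$). $f_{\mid Y}$ is restriction to $\mathcal{P}(Y)$; for disjoint $X,Y$, $f\star_1 g(A)=f(A\cap X)+g(A\cap Y)$. For nonempty $X$, $f$ is indecomposable if $f=f'\star_1f''$ with $f'$ a boolean function on $X\setminus Y$ and $f''$ on $Y$ forces $Y\in\{\emptyset,X\}$. Every $f$ is uniquely the $\star_1$-product of its restrictions to the classes (indecomposable components) of an equivalence on $X$, each restriction indecomposable. An indecomposable $f$ is rigid if for all disjoint $A,B\subseteq X$ with $f(A\sqcup B)=f(A)+f(B)$, $f(A'\sqcup B')=f(A')+f(B')$ for all $A'\subseteq A$, $B'\subseteq B$; a general $f$ is rigid if its restriction to each indecomposable component is rigid. -}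

module Defs where

open import Data.Nat using (ℕ)
open import Data.Integer using (ℤ; +_; _+_; _≤_)
open import Data.Fin.Subset using (Subset; ⊥; _∪_; _∩_; _─_; _⊆_; ∣_∣; Nonempty)
open import Data.Product using (_×_; Σ)
open import Data.Sum using (_⊎_)
open import Relation.Binary.PropositionalEquality using (_≡_)

-- A finite set X is modelled as Fin n; subsets of X are Subset n.
-- A boolean function on X: f : P(X) → ℤ with f(∅) = 0.
BoolFun : ℕ → Set
BoolFun n = Subset n → ℤ

IsBoolean : ∀ {n} → BoolFun n → Set
IsBoolean f = f ⊥ ≡ + 0

IsMatroidRank : ∀ {n} → BoolFun n → Set
IsMatroidRank {n} f =
  IsBoolean f
  × (∀ (A : Subset n) → (+ 0 ≤ f A) × (f A ≤ + ∣ A ∣))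
  × (∀ (A B : Subset n) → A ⊆ B → f A ≤ f B)
  × (∀ (A B : Subset n) → f (A ∪ B) + f (A ∩ B) ≤ f A + f B)

-- The restriction f|Y is represented by f evaluated only on subsets of Y
-- (boolean functions on a subset Y of X are functions on P(X) of which only
-- the values on subsets of Y matter).

IndecomposableOn : ∀ {n} → BoolFun n → Subset n → Set
IndecomposableOn {n} f Y =
  Nonempty Y
  × (∀ (Z : Subset n) → Z ⊆ Y →
       ∀ (f' f'' : BoolFun n) → IsBoolean f' → IsBoolean f'' →
       (∀ (A : Subset n) → A ⊆ Y → f A ≡ f' (A ∩ (Y ─ Z)) + f'' (A ∩ Z)) →
       (Z ≡ ⊥) ⊎ (Z ≡ Y))

-- Y is an indecomposable component of f: f = f|Y ⋆₁ f|(X∖Y), and f|Y is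
-- indecomposable.  (These are exactly the classes of the equivalence in the
-- unique decomposition of f.)
IsComponent : ∀ {n} → BoolFun n → Subset n → Set
IsComponent {n} f Y =
  (∀ (A : Subset n) → f A ≡ f (A ∩ Y) + f (A ─ Y))
  × IndecomposableOn f Y

RigidOn : ∀ {n} → BoolFun n → Subset n → Set
RigidOn {n} f Y =
  ∀ (A B : Subset n) → A ⊆ Y → B ⊆ Y → A ∩ B ≡ ⊥ →
  f (A ∪ B) ≡ f A + f B →
  ∀ (A' B' : Subset n) → A' ⊆ A → B' ⊆ B →
  f (A' ∪ B') ≡ f A' + f B'

Rigid : ∀ {n} → BoolFun n → Set
Rigid {n} f = ∀ (Y : Subset n) → IsComponent f Y → RigidOn f Y

{-# OPTIONS --safe #-}
-- Only normalisation and submodularity of the rank function matter.  If A and B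
-- are disjoint with f (A ∪ B) = f A + f B and A' ⊆ A, then submodularity for the
-- pair A' ∪ B, A gives f A' + f B ≤ f (A' ∪ B), while submodularity for the
-- disjoint pair A', B gives the reverse inequality.  Shrinking the two sides one
-- at a time shows that f is rigid on every subset of X, in particular on each
-- indecomposable component.
module Submission where

open import Defs
open import Data.Nat using (ℕ)
open import Data.Product using (_×_; _,_)
open import Data.Sum using ([_,_])
open import Function using (id; _∘_)
open import Data.Fin.Subset using (Subset; ⊥; _∪_; _∩_; _⊆_; _∈_)
open import Data.Fin.Subset.Properties
  using (⊆-antisym; ⊥⊆; p∩q⊆p; q⊆p∪q; x∈p∩q⁺; x∈p∩q⁻; x∈p∪q⁻;
         ∩-comm; ∪-comm; ∪-assoc; ∪-identityʳ; ∩-distribʳ-∪)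
open import Data.Integer using (ℤ; 0ℤ; -_; _+_; _≤_)
open import Data.Integer.Properties
  using (+-0-abelianGroup; +-comm; +-assoc; +-identityʳ; +-monoʳ-≤; ≤-antisym; module ≤-Reasoning)
open import Algebra.Properties.AbelianGroup +-0-abelianGroup using (\\-leftDividesʳ)
open import Relation.Binary.PropositionalEquality
  using (_≡_; sym; trans; cong; cong₂; subst; module ≡-Reasoning)

Submodular : ∀ {n} → BoolFun n → Set
Submodular {n} f = ∀ (A B : Subset n) → f (A ∪ B) + f (A ∩ B) ≤ f A + f B

Separated : ∀ {n} → BoolFun n → Subset n → Subset n → Set
Separated f A B = f (A ∪ B) ≡ f A + f B

module _ {n : ℕ} {p q r : Subset n} where

  p⊆q⇒p∩q≡p : p ⊆ q → p ∩ q ≡ p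
  p⊆q⇒p∩q≡p p⊆q = ⊆-antisym (p∩q⊆p p q) (λ x∈p → x∈p∩q⁺ (x∈p , p⊆q x∈p))

  p⊆q⇒p∪q≡q : p ⊆ q → p ∪ q ≡ q
  p⊆q⇒p∪q≡q p⊆q = ⊆-antisym (λ x∈p∪q → [ p⊆q , id ] (x∈p∪q⁻ p q x∈p∪q)) (q⊆p∪q p q)

  p⊆q∧q∩r≡⊥⇒p∩r≡⊥ : p ⊆ q → q ∩ r ≡ ⊥ → p ∩ r ≡ ⊥
  p⊆q∧q∩r≡⊥⇒p∩r≡⊥ p⊆q q∩r≡⊥ = ⊆-antisym p∩r⊆⊥ ⊥⊆
    where
    p∩r⊆⊥ : p ∩ r ⊆ ⊥
    p∩r⊆⊥ x∈p∩r with x∈p∩q⁻ p r x∈p∩r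
    ... | x∈p , x∈r = subst (_ ∈_) q∩r≡⊥ (x∈p∩q⁺ (p⊆q x∈p , x∈r))

  [p∪r]∪q≡q∪r : p ⊆ q → (p ∪ r) ∪ q ≡ q ∪ r
  [p∪r]∪q≡q∪r p⊆q = begin
    (p ∪ r) ∪ q  ≡⟨ ∪-assoc p r q ⟩
    p ∪ (r ∪ q)  ≡⟨ cong (p ∪_) (∪-comm r q) ⟩
    p ∪ (q ∪ r)  ≡⟨ sym (∪-assoc p q r) ⟩
    (p ∪ q) ∪ r  ≡⟨ cong (_∪ r) (p⊆q⇒p∪q≡q p⊆q) ⟩
    q ∪ r        ∎
    where open ≡-Reasoning

  [p∪r]∩q≡p : p ⊆ q → q ∩ r ≡ ⊥ → (p ∪ r) ∩ q ≡ p
  [p∪r]∩q≡p p⊆q q∩r≡⊥ = begin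
    (p ∪ r) ∩ q        ≡⟨ ∩-distribʳ-∪ q p r ⟩
    (p ∩ q) ∪ (r ∩ q)  ≡⟨ cong₂ _∪_ (p⊆q⇒p∩q≡p p⊆q) (trans (∩-comm r q) q∩r≡⊥) ⟩
    p ∪ ⊥              ≡⟨ ∪-identityʳ p ⟩
    p                  ∎
    where open ≡-Reasoning

+-cancelˡ-≤ : ∀ i {j k : ℤ} → i + j ≤ i + k → j ≤ k
+-cancelˡ-≤ i {j} {k} i+j≤i+k = begin
  j                ≡⟨ sym (\\-leftDividesʳ i j) ⟩
  - i + (i + j)    ≤⟨ +-monoʳ-≤ (- i) i+j≤i+k ⟩
  - i + (i + k)    ≡⟨ \\-leftDividesʳ i k ⟩
  k                ∎
  where open ≤-Reasoning

separated-sym : ∀ {n} {f : BoolFun n} {A B : Subset n} → Separated f A B → Separated f B A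
separated-sym {f = f} {A} {B} sep = begin
  f (B ∪ A)  ≡⟨ cong f (∪-comm B A) ⟩
  f (A ∪ B)  ≡⟨ sep ⟩
  f A + f B  ≡⟨ +-comm (f A) (f B) ⟩
  f B + f A  ∎
  where open ≡-Reasoning

module _ {n : ℕ} (f : BoolFun n) (f⊥≡0 : IsBoolean f) (submodular : Submodular f) where

  disjoint⇒subadditive : ∀ {A B : Subset n} → A ∩ B ≡ ⊥ → f (A ∪ B) ≤ f A + f B
  disjoint⇒subadditive {A} {B} A∩B≡⊥ = begin
    f (A ∪ B)              ≡⟨ sym (+-identityʳ (f (A ∪ B))) ⟩
    f (A ∪ B) + 0ℤ         ≡⟨ cong (f (A ∪ B) +_) (trans (sym f⊥≡0) (cong f (sym A∩B≡⊥))) ⟩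
    f (A ∪ B) + f (A ∩ B)  ≤⟨ submodular A B ⟩
    f A + f B              ∎
    where open ≤-Reasoning

  separated-shrinkˡ : ∀ {A B A' : Subset n} → A ∩ B ≡ ⊥ → A' ⊆ A →
                      Separated f A B → Separated f A' B
  separated-shrinkˡ {A} {B} {A'} A∩B≡⊥ A'⊆A sep =
    ≤-antisym (disjoint⇒subadditive (p⊆q∧q∩r≡⊥⇒p∩r≡⊥ A'⊆A A∩B≡⊥)) superadditive
    where
    open ≤-Reasoning
    superadditive : f A' + f B ≤ f (A' ∪ B)
    superadditive = +-cancelˡ-≤ (f A) (begin
      f A + (f A' + f B)                   ≡⟨ cong (f A +_) (+-comm (f A') (f B)) ⟩
      f A + (f B + f A')                   ≡⟨ sym (+-assoc (f A) (f B) (f A')) ⟩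
      f A + f B + f A'                     ≡⟨ cong₂ _+_ (sym sep) (cong f (sym ([p∪r]∩q≡p A'⊆A A∩B≡⊥))) ⟩
      f (A ∪ B) + f ((A' ∪ B) ∩ A)         ≡⟨ cong (λ S → f S + f ((A' ∪ B) ∩ A)) (sym ([p∪r]∪q≡q∪r A'⊆A)) ⟩
      f ((A' ∪ B) ∪ A) + f ((A' ∪ B) ∩ A)  ≤⟨ submodular (A' ∪ B) A ⟩
      f (A' ∪ B) + f A                     ≡⟨ +-comm (f (A' ∪ B)) (f A) ⟩
      f A + f (A' ∪ B)                     ∎)

  separated-shrink : ∀ {A B A' B' : Subset n} → A ∩ B ≡ ⊥ → A' ⊆ A → B' ⊆ B →
                     Separated f A B → Separated f A' B'
  separated-shrink {A} {B} {A'} A∩B≡⊥ A'⊆A B'⊆B =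
    separated-sym {f = f} ∘ separated-shrinkˡ B∩A'≡⊥ B'⊆B ∘ separated-sym {f = f}
    ∘ separated-shrinkˡ A∩B≡⊥ A'⊆A
    where
    B∩A'≡⊥ : B ∩ A' ≡ ⊥
    B∩A'≡⊥ = trans (∩-comm B A') (p⊆q∧q∩r≡⊥⇒p∩r≡⊥ A'⊆A A∩B≡⊥)

  submodular⇒rigidOn : ∀ (Y : Subset n) → RigidOn f Y
  submodular⇒rigidOn _ _ _ _ _ A∩B≡⊥ sep _ _ A'⊆A B'⊆B = separated-shrink A∩B≡⊥ A'⊆A B'⊆B sep

proposition4p24 : ∀ (n : ℕ) (f : BoolFun n) → IsMatroidRank f → IsBoolean f × Rigid f
proposition4p24 _ f (f⊥≡0 , _ , _ , submodular) =
  f⊥≡0 , λ Y _ → submodular⇒rigidOn f f⊥≡0 submodular Y
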